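{- Let $f_7=b^2(7a^5-b^5)$, $g_7=a^2(a^5+7b^5)$, $f_{17}=b^2(17a^{15}+187a^{10}b^5+119a^5b^{10}+b^{15})$, $g_{17}=-a^2(a^{15}-119a^{10}b^5+187a^5b^{10}-17b^{15})$. There are polynomials $\mathbf{D}(\lambda,\mu)$, $\mathbf{c}_4(\lambda,\mu)$, $\mathbf{c}_6(\lambda,\mu)$ in $\lambda,\mu$ with coefficients in the polynomial ring $K[c_4,c_6]$ (in indeterminates $c_4,c_6$) such that, after substituting $c_4=c_4(a,b)$ and $c_6=c_6(a,b)$ into the coefficients, $$\mathbf{D}(\lambda,\mu)=27\,D(\lambda f_7+\mu f_{17},\lambda g_7+\mu g_{17})/D(a,b)^2,$$ $$\mathbf{c}_4(\lambda,\mu)=54^2\,c_4(\lambda f_7+\mu f_{17},\lambda g_7+\mu g_{17}),\qquad \mathbf{c}_6(\lambda,\mu)=54^3\,c_6(\lambda f_7+\mu f_{17},\lambda g_7+\mu g_{17}).$$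
   Context: $K$ is a field of characteristic $0$. $D,c_4,c_6\in\mathbb{Z}[a,b]$ denote the polynomials $D(a,b)=ab(a^{10}-11a^5b^5-b^{10})$, $c_4(a,b)=a^{20}+228a^{15}b^5+494a^{10}b^{10}-228a^5b^{15}+b^{20}$, $c_6(a,b)=-a^{30}+522a^{25}b^5+10005a^{20}b^{10}+10005a^{10}b^{20}-522a^5b^{25}-b^{30}$. -}

module Defs where

open import Level using (_⊔_) renaming (suc to lsuc)
open import Data.Nat using (ℕ; zero; suc)
open import Data.Fin using (Fin)
open import Data.Vec using (Vec; lookup)
open import Data.Product using (∃)
open import Relation.Nullary using (¬_)
open import Algebra.Bundles using (CommutativeRing)

natR : ∀ {c ℓ} (R : CommutativeRing c ℓ) → ℕ → CommutativeRing.Carrier R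
natR R zero    = CommutativeRing.0# R
natR R (suc n) = CommutativeRing._+_ R (CommutativeRing.1# R) (natR R n)

record CharZeroField c ℓ : Set (lsuc (c ⊔ ℓ)) where
  field
    commutativeRing : CommutativeRing c ℓ
  open CommutativeRing commutativeRing public
  natK : ℕ → Carrier
  natK = natR commutativeRing
  field
    0≉1      : ¬ (0# ≈ 1#)
    inverse  : ∀ x → ¬ (x ≈ 0#) → ∃ λ y → x * y ≈ 1#
    charZero : ∀ n → ¬ (natK (suc n) ≈ 0#)

data Poly {c} (A : Set c) (n : ℕ) : Set c where
  con  : A → Poly A n
  var  : Fin n → Poly A n
  _:+_ : Poly A n → Poly A n → Poly A n
  _:*_ : Poly A n → Poly A n → Poly A n
  :-_  : Poly A n → Poly A n

module FieldOps {c ℓ} (K : CharZeroField c ℓ) where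
  open CharZeroField K

  infixr 8 _^_
  _^_ : Carrier → ℕ → Carrier
  x ^ zero  = 1#
  x ^ suc n = x * (x ^ n)

  eval : ∀ {n} → Poly Carrier n → Vec Carrier n → Carrier
  eval (con k)  ρ = k
  eval (var i)  ρ = lookup ρ i
  eval (p :+ q) ρ = eval p ρ + eval q ρ
  eval (p :* q) ρ = eval p ρ * eval q ρ
  eval (:- p)   ρ = - eval p ρ

  Dab : Carrier → Carrier → Carrier
  Dab a b = a * b * ((a ^ 10 + - (natK 11 * a ^ 5 * b ^ 5)) + - (b ^ 10))

  c4ab : Carrier → Carrier → Carrier
  c4ab a b = a ^ 20 + natK 228 * a ^ 15 * b ^ 5 + natK 494 * a ^ 10 * b ^ 10
             + - (natK 228 * a ^ 5 * b ^ 15) + b ^ 20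

  c6ab : Carrier → Carrier → Carrier
  c6ab a b = - (a ^ 30) + natK 522 * a ^ 25 * b ^ 5 + natK 10005 * a ^ 20 * b ^ 10
             + natK 10005 * a ^ 10 * b ^ 20 + - (natK 522 * a ^ 5 * b ^ 25) + - (b ^ 30)

  f7 g7 : Carrier → Carrier → Carrier
  f7 a b = b ^ 2 * (natK 7 * a ^ 5 + - (b ^ 5))
  g7 a b = a ^ 2 * (a ^ 5 + natK 7 * b ^ 5)

  f17 g17 : Carrier → Carrier → Carrier
  f17 a b = b ^ 2 * (natK 17 * a ^ 15 + natK 187 * a ^ 10 * b ^ 5
                     + natK 119 * a ^ 5 * b ^ 10 + b ^ 15)
  g17 a b = - (a ^ 2 * (a ^ 15 + - (natK 119 * a ^ 10 * b ^ 5)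
                        + natK 187 * a ^ 5 * b ^ 10 + - (natK 17 * b ^ 15)))

  pencilX pencilY : Carrier → Carrier → Carrier → Carrier → Carrier
  pencilX a b l m = l * f7 a b + m * f17 a b
  pencilY a b l m = l * g7 a b + m * g17 a b

-- Each claimed identity is an identity between integer polynomials in a, b, λ, μ:
-- with X = λ f₇ + μ f₁₇ and Y = λ g₇ + μ g₁₇ it reads
-- 𝐏(c₄(a,b), c₆(a,b), λ, μ) · D(a,b)ᵏ = F(X, Y), where k = 2 for 𝐃 and k = 0 for 𝐜₄, 𝐜₆,
-- and the polynomials 𝐏 are given explicitly. Both sides are expanded into sparse
-- normal forms over ℤ by evaluation inside Agda and found equal; since the normaliser
-- is sound in every commutative ring, the identities hold in K (in any characteristic).

module Submission where

open import Defs
open import Algebra.Bundles using (CommutativeRing)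
open import Data.Bool using (Bool; true; false; T)
open import Data.Fin using (Fin; zero; suc)
open import Data.Integer as ℤ using (ℤ; +_; -[1+_])
import Data.Integer.Properties as ℤₚ
open import Data.List using (List; []; _∷_; length; map; null; foldr)
open import Data.Maybe using (Maybe; just; nothing; maybe; _>>=_)
open import Data.Nat as ℕ using (ℕ; zero; suc)
import Data.Nat.Properties as ℕₚ
open import Data.Product using (∃; _×_; _,_)
open import Data.Sign as Sign using (Sign)
open import Data.Unit using (tt)
open import Data.Vec using (Vec; _∷_; []; lookup)
open import Function using (id)
open import Relation.Binary.PropositionalEquality as ≡ using (_≡_)

module IntegerEmbedding {c ℓ} (R : CommutativeRing c ℓ) where

  open CommutativeRing R
  open import Algebra.Properties.Ring ring
    using (-‿+-comm; -0#≈0#; -‿involutive; -‿distribˡ-*; -‿distribʳ-*)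
  open import Algebra.Properties.CommutativeSemigroup +-commutativeSemigroup
    using (interchange)
  open import Relation.Binary.Reasoning.Setoid setoid

  natR-homo-+ : ∀ m n → natR R (m ℕ.+ n) ≈ natR R m + natR R n
  natR-homo-+ zero    n = sym (+-identityˡ _)
  natR-homo-+ (suc m) n = trans (+-congˡ (natR-homo-+ m n)) (sym (+-assoc _ _ _))

  natR-homo-* : ∀ m n → natR R (m ℕ.* n) ≈ natR R m * natR R n
  natR-homo-* zero    n = sym (zeroˡ _)
  natR-homo-* (suc m) n = begin
    natR R (n ℕ.+ m ℕ.* n)                ≈⟨ natR-homo-+ n (m ℕ.* n) ⟩
    natR R n + natR R (m ℕ.* n)           ≈⟨ +-cong (sym (*-identityˡ _)) (natR-homo-* m n) ⟩
    1# * natR R n + natR R m * natR R n   ≈⟨ distribʳ _ _ _ ⟨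
    (1# + natR R m) * natR R n            ∎

  ι : ℤ → Carrier
  ι (+ n)    = natR R n
  ι -[1+ n ] = - natR R (suc n)

  ι-homo-⊖ : ∀ m n → ι (m ℤ.⊖ n) ≈ natR R m + - natR R n
  ι-homo-⊖ zero    zero    = sym (trans (+-identityˡ _) -0#≈0#)
  ι-homo-⊖ zero    (suc n) = sym (+-identityˡ _)
  ι-homo-⊖ (suc m) zero    = sym (trans (+-congˡ -0#≈0#) (+-identityʳ _))
  ι-homo-⊖ (suc m) (suc n) = begin
    ι (suc m ℤ.⊖ suc n)                     ≡⟨ ≡.cong ι (ℤₚ.[1+m]⊖[1+n]≡m⊖n m n) ⟩
    ι (m ℤ.⊖ n)                             ≈⟨ ι-homo-⊖ m n ⟩
    natR R m + - natR R n                   ≈⟨ +-identityˡ _ ⟨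
    0# + (natR R m + - natR R n)            ≈⟨ +-congʳ (-‿inverseʳ 1#) ⟨
    (1# + - 1#) + (natR R m + - natR R n)   ≈⟨ interchange _ _ _ _ ⟩
    (1# + natR R m) + (- 1# + - natR R n)   ≈⟨ +-congˡ (-‿+-comm 1# _) ⟩
    (1# + natR R m) + - (1# + natR R n)     ∎

  ι-homo-+ : ∀ i j → ι (i ℤ.+ j) ≈ ι i + ι j
  ι-homo-+ (+ m)    (+ n)    = natR-homo-+ m n
  ι-homo-+ (+ m)    -[1+ n ] = ι-homo-⊖ m (suc n)
  ι-homo-+ -[1+ m ] (+ n)    = trans (ι-homo-⊖ n (suc m)) (+-comm _ _)
  ι-homo-+ -[1+ m ] -[1+ n ] = begin
    - natR R (suc (suc (m ℕ.+ n)))        ≡⟨ ≡.cong (λ k → - natR R (suc k)) (ℕₚ.+-suc m n) ⟨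
    - natR R (suc m ℕ.+ suc n)            ≈⟨ -‿cong (natR-homo-+ (suc m) (suc n)) ⟩
    - (natR R (suc m) + natR R (suc n))   ≈⟨ -‿+-comm _ _ ⟨
    ι -[1+ m ] + ι -[1+ n ]               ∎

  ι-homo‿- : ∀ i → ι (ℤ.- i) ≈ - ι i
  ι-homo‿- (+ zero)  = sym -0#≈0#
  ι-homo‿- (+ suc n) = refl
  ι-homo‿- -[1+ n ]  = sym (-‿involutive _)

  signed : Sign → Carrier → Carrier
  signed Sign.+ x = x
  signed Sign.- x = - x

  signed-cong : ∀ s {x y} → x ≈ y → signed s x ≈ signed s y
  signed-cong Sign.+ x≈y = x≈y
  signed-cong Sign.- x≈y = -‿cong x≈y

  signed-homo-* : ∀ s t x y → signed (s Sign.* t) (x * y) ≈ signed s x * signed t y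
  signed-homo-* Sign.+ Sign.+ x y = refl
  signed-homo-* Sign.+ Sign.- x y = -‿distribʳ-* x y
  signed-homo-* Sign.- Sign.+ x y = -‿distribˡ-* x y
  signed-homo-* Sign.- Sign.- x y = begin
    x * y           ≈⟨ -‿involutive _ ⟨
    - - (x * y)     ≈⟨ -‿cong (-‿distribʳ-* x y) ⟩
    - (x * - y)     ≈⟨ -‿distribˡ-* x (- y) ⟩
    - x * - y       ∎

  ι-◃ : ∀ s n → ι (s ℤ.◃ n) ≈ signed s (natR R n)
  ι-◃ Sign.+ zero    = refl
  ι-◃ Sign.- zero    = sym -0#≈0#
  ι-◃ Sign.+ (suc n) = refl
  ι-◃ Sign.- (suc n) = refl

  ι≈signed : ∀ i → ι i ≈ signed (ℤ.sign i) (natR R ℤ.∣ i ∣)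
  ι≈signed (+ n)    = refl
  ι≈signed -[1+ n ] = refl

  ι-homo-* : ∀ i j → ι (i ℤ.* j) ≈ ι i * ι j
  ι-homo-* i j = begin
    ι (s ℤ.◃ (ℤ.∣ i ∣ ℕ.* ℤ.∣ j ∣))                        ≈⟨ ι-◃ s (ℤ.∣ i ∣ ℕ.* ℤ.∣ j ∣) ⟩
    signed s (natR R (ℤ.∣ i ∣ ℕ.* ℤ.∣ j ∣))                ≈⟨ signed-cong s (natR-homo-* ℤ.∣ i ∣ ℤ.∣ j ∣) ⟩
    signed s (natR R ℤ.∣ i ∣ * natR R ℤ.∣ j ∣)             ≈⟨ signed-homo-* (ℤ.sign i) (ℤ.sign j) _ _ ⟩
    signed (ℤ.sign i) (natR R ℤ.∣ i ∣) * signed (ℤ.sign j) (natR R ℤ.∣ j ∣)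
                                                          ≈⟨ *-cong (ι≈signed i) (ι≈signed j) ⟨
    ι i * ι j                                             ∎
    where s = ℤ.sign i Sign.* ℤ.sign j

  ι-homo-1 : ι (+ 1) ≈ 1#
  ι-homo-1 = +-identityʳ 1#

data Monomial : Set where
  monomial : (e₀ e₁ e₂ e₃ : ℕ) → Monomial

infixl 7 _*ₘ_
_*ₘ_ : Monomial → Monomial → Monomial
monomial a b c d *ₘ monomial a′ b′ c′ d′ =
  monomial (a ℕ.+ a′) (b ℕ.+ b′) (c ℕ.+ c′) (d ℕ.+ d′)

unitMonomial : Monomial
unitMonomial = monomial 0 0 0 0

X : Fin 4 → Monomial
X zero                   = monomial 1 0 0 0
X (suc zero)             = monomial 0 1 0 0
X (suc (suc zero))       = monomial 0 0 1 0
X (suc (suc (suc zero))) = monomial 0 0 0 1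

-- Terms are kept sorted by this key only to make addition a linear merge.
-- Soundness uses nothing but the `same` case of the comparison, so a key
-- collision (an exponent ≥ 1024) could only cost canonicity, never correctness.
key : Monomial → ℕ
key (monomial a b c d) = a ℕ.+ 1024 ℕ.* (b ℕ.+ 1024 ℕ.* (c ℕ.+ 1024 ℕ.* d))

data Comparison (x y : Monomial) : Set where
  before after : Comparison x y
  same         : x ≡ y → Comparison x y

monomial-≡ : ∀ {a b c d a′ b′ c′ d′} → a ≡ a′ → b ≡ b′ → c ≡ c′ → d ≡ d′ →
             monomial a b c d ≡ monomial a′ b′ c′ d′
monomial-≡ ≡.refl ≡.refl ≡.refl ≡.refl = ≡.refl

≡ᵇ-true⇒≡ : ∀ {m n} → (m ℕ.≡ᵇ n) ≡ true → m ≡ n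
≡ᵇ-true⇒≡ {m} {n} m≡ᵇn = ℕₚ.≡ᵇ⇒≡ m n (≡.subst T (≡.sym m≡ᵇn) tt)

-- Boolean tests rather than `_≟_`: the equality proof is then only built when the
-- soundness proof inspects it, which makes evaluating normal forms markedly faster.
compareExponents : (x y : Monomial) → Comparison x y
compareExponents (monomial a b c d) (monomial a′ b′ c′ d′)
  with a ℕ.≡ᵇ a′ in p | b ℕ.≡ᵇ b′ in q | c ℕ.≡ᵇ c′ in r | d ℕ.≡ᵇ d′ in s
... | true | true | true | true =
  same (monomial-≡ (≡ᵇ-true⇒≡ p) (≡ᵇ-true⇒≡ q) (≡ᵇ-true⇒≡ r) (≡ᵇ-true⇒≡ s))
... | _    | _    | _    | _    = before

compareMonomials : (x y : Monomial) → Comparison x y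
compareMonomials x y with key x ℕ.<ᵇ key y
... | true  = before
... | false with key y ℕ.<ᵇ key x
...   | true  = after
...   | false = compareExponents x y

infix 8 _·_
data Term : Set where
  _·_ : ℤ → Monomial → Term

NF : Set
NF = List Term

prepend : ℤ → Monomial → NF → NF
prepend (+ zero) x p = p
prepend c        x p = c · x ∷ p

infixl 6 _+ᴺ_
_+ᴺ_  : NF → NF → NF
merge : Term → NF → NF → NF

[]      +ᴺ q = q
(t ∷ p) +ᴺ q = merge t p q

merge t p [] = t ∷ p
merge (c · x) p (d · y ∷ q) with compareMonomials x y
... | before = c · x ∷ (p +ᴺ (d · y ∷ q))
... | after  = d · y ∷ merge (c · x) p q
... | same _ = prepend (c ℤ.+ d) x (p +ᴺ q)

infixl 7 _*ₜ_
_*ₜ_ : Term → Term → Term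
(c · x) *ₜ (d · y) = (c ℤ.* d) · (x *ₘ y)

scale : Term → NF → NF
scale t = map (t *ₜ_)

multiply : NF → NF → NF
multiply p []      = []
multiply p (t ∷ q) = scale t p +ᴺ multiply p q

infixl 7 _*ᴺ_
_*ᴺ_ : NF → NF → NF
p *ᴺ q with length q ℕ.<ᵇ length p
... | true  = multiply p q
... | false = multiply q p

negate : Term → Term
negate (c · x) = (ℤ.- c) · x

-ᴺ_ : NF → NF
-ᴺ_ = map negate

constᴺ : ℤ → NF
constᴺ c = prepend c unitMonomial []

varᴺ : Fin 4 → NF
varᴺ i = (+ 1) · X i ∷ []

infixr 8 _^ᴺ_
_^ᴺ_ : NF → ℕ → NF
p ^ᴺ zero  = constᴺ (+ 1)
p ^ᴺ suc n = p *ᴺ p ^ᴺ n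

infix 4 _==ᴺ_
_==ᴺ_ : NF → NF → Bool
p ==ᴺ q = null (p +ᴺ -ᴺ q)

infixl 6 _⊕_
infixl 7 _⊗_
infixr 8 _⊛_
data Expr : Set where
  var     : Fin 4 → Expr
  con     : ℤ → Expr
  _⊕_ _⊗_ : Expr → Expr → Expr
  ⊝_      : Expr → Expr
  _⊛_     : Expr → ℕ → Expr

normalise : Expr → NF
normalise (var i) = varᴺ i
normalise (con c) = constᴺ c
normalise (e ⊕ f) = normalise e +ᴺ normalise f
normalise (e ⊗ f) = normalise e *ᴺ normalise f
normalise (⊝ e)   = -ᴺ normalise e
normalise (e ⊛ n) = normalise e ^ᴺ n

_!?_ : {A : Set} → List A → ℕ → Maybe A
[]       !? _     = nothing
(x ∷ xs) !? zero  = just x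
(x ∷ xs) !? suc i = xs !? i

-- To substitute g and f for X₀ and X₁, the products gᵖ fᵠ needed are computed once,
-- as a table whose row q lists gᵖ fᵠ for p = 0, 1, …; a product missing from the
-- table is computed directly, so soundness does not depend on the table's shape.
powerRow : NF → NF → ℕ → List NF
powerRow g h zero    = h ∷ []
powerRow g h (suc n) = h ∷ powerRow g (g *ᴺ h) n

powerTable : NF → NF → NF → List ℕ → List (List NF)
powerTable g f h []       = []
powerTable g f h (n ∷ ns) = powerRow g h n ∷ powerTable g f (f *ᴺ h) ns

power : NF → NF → List (List NF) → ℕ → ℕ → NF
power g f t p q = maybe id (g ^ᴺ p *ᴺ f ^ᴺ q) (t !? q >>= (_!? p))

raiseAt : ℕ → ℕ → List ℕ → List ℕ
raiseAt zero    p []       = p ∷ []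
raiseAt zero    p (n ∷ ns) = n ℕ.⊔ p ∷ ns
raiseAt (suc q) p []       = 0 ∷ raiseAt q p []
raiseAt (suc q) p (n ∷ ns) = n ∷ raiseAt q p ns

-- Entry q is the largest exponent of X₀ occurring together with X₁ ^ q.
exponentProfile : NF → List ℕ
exponentProfile = foldr (λ { (_ · monomial p q _ _) → raiseAt q p }) []

substituteWith : NF → NF → List (List NF) → NF → NF
substituteWith g f t []                          = []
substituteWith g f t (c · monomial p q i j ∷ r) =
  scale (c · monomial 0 0 i j) (power g f t p q) +ᴺ substituteWith g f t r

substitute₀₁ : NF → NF → NF → NF
substitute₀₁ g f r = substituteWith g f (powerTable g f (constᴺ (+ 1)) (exponentProfile r)) r

module Semantics {c ℓ} (R : CommutativeRing c ℓ) where

  open CommutativeRing R hiding (zero)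
  open IntegerEmbedding R public
  open import Algebra.Properties.Semiring.Exp semiring public using (_^_)
  open import Algebra.Properties.Semiring.Exp semiring using (^-homo-*; ^-congˡ)
  open import Algebra.Properties.Ring ring using (-0#≈0#; -‿distribˡ-*; -‿+-comm; x∙y⁻¹≈ε⇒x≈y)
  open import Algebra.Properties.CommutativeSemigroup +-commutativeSemigroup
    using () renaming (interchange to +-interchange; x∙yz≈y∙xz to x+yz≈y+xz)
  open import Algebra.Properties.CommutativeSemigroup *-commutativeSemigroup
    using () renaming (interchange to *-interchange; x∙yz≈y∙xz to x*yz≈y*xz)
  open import Relation.Binary.Reasoning.Setoid setoid

  Point : Set c
  Point = Vec Carrier 4

  ⟦_⟧ₘ : Monomial → Point → Carrier
  ⟦ monomial e₀ e₁ e₂ e₃ ⟧ₘ ρ =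
    lookup ρ zero ^ e₀ * (lookup ρ (suc zero) ^ e₁
      * (lookup ρ (suc (suc zero)) ^ e₂ * lookup ρ (suc (suc (suc zero))) ^ e₃))

  ⟦_⟧ₜ : Term → Point → Carrier
  ⟦ c · x ⟧ₜ ρ = ι c * ⟦ x ⟧ₘ ρ

  ⟦_⟧ₙ : NF → Point → Carrier
  ⟦ []    ⟧ₙ ρ = 0#
  ⟦ t ∷ p ⟧ₙ ρ = ⟦ t ⟧ₜ ρ + ⟦ p ⟧ₙ ρ

  ⟦_⟧ₑ : Expr → Point → Carrier
  ⟦ var i ⟧ₑ ρ = lookup ρ i
  ⟦ con c ⟧ₑ ρ = ι c
  ⟦ e ⊕ f ⟧ₑ ρ = ⟦ e ⟧ₑ ρ + ⟦ f ⟧ₑ ρ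
  ⟦ e ⊗ f ⟧ₑ ρ = ⟦ e ⟧ₑ ρ * ⟦ f ⟧ₑ ρ
  ⟦ ⊝ e   ⟧ₑ ρ = - ⟦ e ⟧ₑ ρ
  ⟦ e ⊛ n ⟧ₑ ρ = ⟦ e ⟧ₑ ρ ^ n

  _[₀₁≔_,_] : Point → Carrier → Carrier → Point
  ρ [₀₁≔ x₀ , x₁ ] = x₀ ∷ x₁ ∷ lookup ρ (suc (suc zero)) ∷ lookup ρ (suc (suc (suc zero))) ∷ []

  module _ (ρ : Point) where

    private
      x₀ x₁ x₂ x₃ : Carrier
      x₀ = lookup ρ zero
      x₁ = lookup ρ (suc zero)
      x₂ = lookup ρ (suc (suc zero))
      x₃ = lookup ρ (suc (suc (suc zero)))

    *ₘ-sound : ∀ x y → ⟦ x *ₘ y ⟧ₘ ρ ≈ ⟦ x ⟧ₘ ρ * ⟦ y ⟧ₘ ρ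
    *ₘ-sound (monomial a b c d) (monomial a′ b′ c′ d′) = begin
      x₀ ^ (a ℕ.+ a′) * (x₁ ^ (b ℕ.+ b′) * (x₂ ^ (c ℕ.+ c′) * x₃ ^ (d ℕ.+ d′)))
        ≈⟨ *-cong (^-homo-* x₀ a a′) (*-cong (^-homo-* x₁ b b′)
             (*-cong (^-homo-* x₂ c c′) (^-homo-* x₃ d d′))) ⟩
      (x₀ ^ a * x₀ ^ a′) * ((x₁ ^ b * x₁ ^ b′) * ((x₂ ^ c * x₂ ^ c′) * (x₃ ^ d * x₃ ^ d′)))
        ≈⟨ *-congˡ (*-congˡ (*-interchange _ _ _ _)) ⟩
      (x₀ ^ a * x₀ ^ a′) * ((x₁ ^ b * x₁ ^ b′) * ((x₂ ^ c * x₃ ^ d) * (x₂ ^ c′ * x₃ ^ d′)))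
        ≈⟨ *-congˡ (*-interchange _ _ _ _) ⟩
      (x₀ ^ a * x₀ ^ a′) * ((x₁ ^ b * (x₂ ^ c * x₃ ^ d)) * (x₁ ^ b′ * (x₂ ^ c′ * x₃ ^ d′)))
        ≈⟨ *-interchange _ _ _ _ ⟩
      (x₀ ^ a * (x₁ ^ b * (x₂ ^ c * x₃ ^ d))) * (x₀ ^ a′ * (x₁ ^ b′ * (x₂ ^ c′ * x₃ ^ d′))) ∎

    *ₜ-sound : ∀ t u → ⟦ t *ₜ u ⟧ₜ ρ ≈ ⟦ t ⟧ₜ ρ * ⟦ u ⟧ₜ ρ
    *ₜ-sound (c · x) (d · y) = trans (*-cong (ι-homo-* c d) (*ₘ-sound x y)) (*-interchange _ _ _ _)

    prepend-sound : ∀ c x p → ⟦ prepend c x p ⟧ₙ ρ ≈ ⟦ c · x ⟧ₜ ρ + ⟦ p ⟧ₙ ρ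
    prepend-sound (+ zero)  x p = sym (trans (+-congʳ (zeroˡ _)) (+-identityˡ _))
    prepend-sound (+ suc n) x p = refl
    prepend-sound -[1+ n ]  x p = refl

    +ᴺ-sound    : ∀ p q → ⟦ p +ᴺ q ⟧ₙ ρ ≈ ⟦ p ⟧ₙ ρ + ⟦ q ⟧ₙ ρ
    merge-sound : ∀ t p q → ⟦ merge t p q ⟧ₙ ρ ≈ ⟦ t ∷ p ⟧ₙ ρ + ⟦ q ⟧ₙ ρ

    +ᴺ-sound []      q = sym (+-identityˡ _)
    +ᴺ-sound (t ∷ p) q = merge-sound t p q

    merge-sound t p [] = sym (+-identityʳ _)
    merge-sound (c · x) p (d · y ∷ q) with compareMonomials x y
    ... | before = trans (+-congˡ (+ᴺ-sound p (d · y ∷ q))) (sym (+-assoc _ _ _))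
    ... | after  = trans (+-congˡ (merge-sound (c · x) p q)) (x+yz≈y+xz _ _ _)
    ... | same ≡.refl = begin
      ⟦ prepend (c ℤ.+ d) x (p +ᴺ q) ⟧ₙ ρ
        ≈⟨ prepend-sound (c ℤ.+ d) x (p +ᴺ q) ⟩
      ι (c ℤ.+ d) * ⟦ x ⟧ₘ ρ + ⟦ p +ᴺ q ⟧ₙ ρ
        ≈⟨ +-cong (trans (*-congʳ (ι-homo-+ c d)) (distribʳ _ _ _)) (+ᴺ-sound p q) ⟩
      (ι c * ⟦ x ⟧ₘ ρ + ι d * ⟦ x ⟧ₘ ρ) + (⟦ p ⟧ₙ ρ + ⟦ q ⟧ₙ ρ)
        ≈⟨ +-interchange _ _ _ _ ⟩
      (ι c * ⟦ x ⟧ₘ ρ + ⟦ p ⟧ₙ ρ) + (ι d * ⟦ x ⟧ₘ ρ + ⟦ q ⟧ₙ ρ) ∎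

    scale-sound : ∀ t p → ⟦ scale t p ⟧ₙ ρ ≈ ⟦ t ⟧ₜ ρ * ⟦ p ⟧ₙ ρ
    scale-sound t []      = sym (zeroʳ _)
    scale-sound t (u ∷ p) = trans (+-cong (*ₜ-sound t u) (scale-sound t p)) (sym (distribˡ _ _ _))

    multiply-sound : ∀ p q → ⟦ multiply p q ⟧ₙ ρ ≈ ⟦ p ⟧ₙ ρ * ⟦ q ⟧ₙ ρ
    multiply-sound p []      = sym (zeroʳ _)
    multiply-sound p (t ∷ q) = begin
      ⟦ scale t p +ᴺ multiply p q ⟧ₙ ρ          ≈⟨ +ᴺ-sound (scale t p) (multiply p q) ⟩
      ⟦ scale t p ⟧ₙ ρ + ⟦ multiply p q ⟧ₙ ρ    ≈⟨ +-cong (trans (scale-sound t p) (*-comm _ _))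
                                                          (multiply-sound p q) ⟩
      ⟦ p ⟧ₙ ρ * ⟦ t ⟧ₜ ρ + ⟦ p ⟧ₙ ρ * ⟦ q ⟧ₙ ρ  ≈⟨ distribˡ _ _ _ ⟨
      ⟦ p ⟧ₙ ρ * (⟦ t ⟧ₜ ρ + ⟦ q ⟧ₙ ρ)          ∎

    *ᴺ-sound : ∀ p q → ⟦ p *ᴺ q ⟧ₙ ρ ≈ ⟦ p ⟧ₙ ρ * ⟦ q ⟧ₙ ρ
    *ᴺ-sound p q with length q ℕ.<ᵇ length p
    ... | true  = multiply-sound p q
    ... | false = trans (multiply-sound q p) (*-comm _ _)

    -ᴺ-sound : ∀ p → ⟦ -ᴺ p ⟧ₙ ρ ≈ - ⟦ p ⟧ₙ ρ
    -ᴺ-sound []          = sym -0#≈0#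
    -ᴺ-sound (c · x ∷ p) = begin
      ι (ℤ.- c) * ⟦ x ⟧ₘ ρ + ⟦ -ᴺ p ⟧ₙ ρ  ≈⟨ +-cong (*-congʳ (ι-homo‿- c)) (-ᴺ-sound p) ⟩
      - ι c * ⟦ x ⟧ₘ ρ + - ⟦ p ⟧ₙ ρ       ≈⟨ +-congʳ (-‿distribˡ-* _ _) ⟨
      - (ι c * ⟦ x ⟧ₘ ρ) + - ⟦ p ⟧ₙ ρ     ≈⟨ -‿+-comm _ _ ⟩
      - (ι c * ⟦ x ⟧ₘ ρ + ⟦ p ⟧ₙ ρ)       ∎

    constᴺ-sound : ∀ c → ⟦ constᴺ c ⟧ₙ ρ ≈ ι c
    constᴺ-sound c = begin
      ⟦ prepend c unitMonomial [] ⟧ₙ ρ    ≈⟨ prepend-sound c unitMonomial [] ⟩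
      ι c * (1# * (1# * (1# * 1#))) + 0#   ≈⟨ +-identityʳ _ ⟩
      ι c * (1# * (1# * (1# * 1#)))        ≈⟨ *-congˡ (trans (*-identityˡ _) (trans (*-identityˡ _) (*-identityˡ _))) ⟩
      ι c * 1#                             ≈⟨ *-identityʳ _ ⟩
      ι c                                  ∎

    X-sound : ∀ i → ⟦ X i ⟧ₘ ρ ≈ lookup ρ i
    X-sound zero =
      trans (*-cong (*-identityʳ _) (trans (*-identityˡ _) (*-identityˡ _))) (*-identityʳ _)
    X-sound (suc zero) =
      trans (*-identityˡ _) (trans (*-cong (*-identityʳ _) (*-identityˡ _)) (*-identityʳ _))
    X-sound (suc (suc zero)) =
      trans (*-identityˡ _) (trans (*-identityˡ _) (trans (*-cong (*-identityʳ _) refl) (*-identityʳ _)))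
    X-sound (suc (suc (suc zero))) =
      trans (*-identityˡ _) (trans (*-identityˡ _) (trans (*-identityˡ _) (*-identityʳ _)))

    varᴺ-sound : ∀ i → ⟦ varᴺ i ⟧ₙ ρ ≈ lookup ρ i
    varᴺ-sound i = trans (+-identityʳ _) (trans (*-cong ι-homo-1 (X-sound i)) (*-identityˡ _))

    ^ᴺ-sound : ∀ p n → ⟦ p ^ᴺ n ⟧ₙ ρ ≈ ⟦ p ⟧ₙ ρ ^ n
    ^ᴺ-sound p zero    = trans (constᴺ-sound (+ 1)) ι-homo-1
    ^ᴺ-sound p (suc n) = trans (*ᴺ-sound p (p ^ᴺ n)) (*-congˡ (^ᴺ-sound p n))

    normalise-sound : ∀ e → ⟦ normalise e ⟧ₙ ρ ≈ ⟦ e ⟧ₑ ρ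
    normalise-sound (var i) = varᴺ-sound i
    normalise-sound (con c) = constᴺ-sound c
    normalise-sound (e ⊕ f) = trans (+ᴺ-sound (normalise e) (normalise f)) (+-cong (normalise-sound e) (normalise-sound f))
    normalise-sound (e ⊗ f) = trans (*ᴺ-sound (normalise e) (normalise f)) (*-cong (normalise-sound e) (normalise-sound f))
    normalise-sound (⊝ e)   = trans (-ᴺ-sound (normalise e)) (-‿cong (normalise-sound e))
    normalise-sound (e ⊛ n) = trans (^ᴺ-sound (normalise e) n) (^-congˡ n (normalise-sound e))

    ==ᴺ-sound : ∀ p q → (p ==ᴺ q) ≡ true → ⟦ p ⟧ₙ ρ ≈ ⟦ q ⟧ₙ ρ
    ==ᴺ-sound p q p==q = x∙y⁻¹≈ε⇒x≈y _ _ (begin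
      ⟦ p ⟧ₙ ρ + - ⟦ q ⟧ₙ ρ      ≈⟨ +-congˡ (-ᴺ-sound q) ⟨
      ⟦ p ⟧ₙ ρ + ⟦ -ᴺ q ⟧ₙ ρ     ≈⟨ +ᴺ-sound p (-ᴺ q) ⟨
      ⟦ p +ᴺ -ᴺ q ⟧ₙ ρ           ≈⟨ null⇒≈0 (p +ᴺ -ᴺ q) p==q ⟩
      0#                          ∎)
      where
      null⇒≈0 : ∀ r → null r ≡ true → ⟦ r ⟧ₙ ρ ≈ 0#
      null⇒≈0 [] _ = refl

    powerRow-sound : ∀ g h n i {e} → powerRow g h n !? i ≡ just e →
                     ⟦ e ⟧ₙ ρ ≈ ⟦ g ⟧ₙ ρ ^ i * ⟦ h ⟧ₙ ρ
    powerRow-sound g h zero    zero    ≡.refl = sym (*-identityˡ _)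
    powerRow-sound g h (suc n) zero    ≡.refl = sym (*-identityˡ _)
    powerRow-sound g h (suc n) (suc i) {e} entry = begin
      ⟦ e ⟧ₙ ρ                                   ≈⟨ powerRow-sound g (g *ᴺ h) n i entry ⟩
      ⟦ g ⟧ₙ ρ ^ i * ⟦ g *ᴺ h ⟧ₙ ρ              ≈⟨ *-congˡ (*ᴺ-sound g h) ⟩
      ⟦ g ⟧ₙ ρ ^ i * (⟦ g ⟧ₙ ρ * ⟦ h ⟧ₙ ρ)      ≈⟨ *-assoc _ _ _ ⟨
      (⟦ g ⟧ₙ ρ ^ i * ⟦ g ⟧ₙ ρ) * ⟦ h ⟧ₙ ρ      ≈⟨ *-congʳ (*-comm _ _) ⟩
      ⟦ g ⟧ₙ ρ ^ suc i * ⟦ h ⟧ₙ ρ               ∎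

    powerTable-sound : ∀ g f h ns p q {e} → (powerTable g f h ns !? q >>= (_!? p)) ≡ just e →
                       ⟦ e ⟧ₙ ρ ≈ ⟦ g ⟧ₙ ρ ^ p * (⟦ f ⟧ₙ ρ ^ q * ⟦ h ⟧ₙ ρ)
    powerTable-sound g f h (n ∷ ns) p zero    entry =
      trans (powerRow-sound g h n p entry) (*-congˡ (sym (*-identityˡ _)))
    powerTable-sound g f h (n ∷ ns) p (suc q) {e} entry = begin
      ⟦ e ⟧ₙ ρ                                          ≈⟨ powerTable-sound g f (f *ᴺ h) ns p q entry ⟩
      ⟦ g ⟧ₙ ρ ^ p * (⟦ f ⟧ₙ ρ ^ q * ⟦ f *ᴺ h ⟧ₙ ρ)      ≈⟨ *-congˡ (*-congˡ (*ᴺ-sound f h)) ⟩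
      ⟦ g ⟧ₙ ρ ^ p * (⟦ f ⟧ₙ ρ ^ q * (⟦ f ⟧ₙ ρ * ⟦ h ⟧ₙ ρ)) ≈⟨ *-congˡ (x*yz≈y*xz _ _ _) ⟩
      ⟦ g ⟧ₙ ρ ^ p * (⟦ f ⟧ₙ ρ * (⟦ f ⟧ₙ ρ ^ q * ⟦ h ⟧ₙ ρ)) ≈⟨ *-congˡ (*-assoc _ _ _) ⟨
      ⟦ g ⟧ₙ ρ ^ p * (⟦ f ⟧ₙ ρ ^ suc q * ⟦ h ⟧ₙ ρ)       ∎

    power-sound : ∀ g f ns p q →
                  ⟦ power g f (powerTable g f (constᴺ (+ 1)) ns) p q ⟧ₙ ρ ≈ ⟦ g ⟧ₙ ρ ^ p * ⟦ f ⟧ₙ ρ ^ q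
    power-sound g f ns p q =
      maybe-sound (trans (*ᴺ-sound (g ^ᴺ p) (f ^ᴺ q)) (*-cong (^ᴺ-sound g p) (^ᴺ-sound f q)))
                  (λ entry → trans (powerTable-sound g f (constᴺ (+ 1)) ns p q entry)
                                   (*-congˡ (trans (*-congˡ (trans (constᴺ-sound (+ 1)) ι-homo-1)) (*-identityʳ _))))
      where
      maybe-sound : ∀ {d m x} → ⟦ d ⟧ₙ ρ ≈ x → (∀ {e} → m ≡ just e → ⟦ e ⟧ₙ ρ ≈ x) →
                    ⟦ maybe id d m ⟧ₙ ρ ≈ x
      maybe-sound {m = just e}  _        entry = entry ≡.refl
      maybe-sound {m = nothing} fallback _     = fallback

    substitute₀₁-sound : ∀ g f r {G F} → ⟦ g ⟧ₙ ρ ≈ G → ⟦ f ⟧ₙ ρ ≈ F →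
                         ⟦ substitute₀₁ g f r ⟧ₙ ρ ≈ ⟦ r ⟧ₙ (ρ [₀₁≔ G , F ])
    substitute₀₁-sound g f r {G} {F} g≈G f≈F = go r
      where
      ns    = exponentProfile r
      table = powerTable g f (constᴺ (+ 1)) ns

      go : ∀ s → ⟦ substituteWith g f table s ⟧ₙ ρ ≈ ⟦ s ⟧ₙ (ρ [₀₁≔ G , F ])
      go []                          = refl
      go (c · monomial p q i j ∷ s) =
        trans (+ᴺ-sound (scale (c · monomial 0 0 i j) (power g f table p q)) (substituteWith g f table s))
              (+-cong term (go s))
        where
        M = x₂ ^ i * x₃ ^ j
        term : ⟦ scale (c · monomial 0 0 i j) (power g f table p q) ⟧ₙ ρ ≈ ι c * (G ^ p * (F ^ q * M))
        term = begin
          ⟦ scale (c · monomial 0 0 i j) (power g f table p q) ⟧ₙ ρ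
            ≈⟨ scale-sound _ (power g f table p q) ⟩
          (ι c * (1# * (1# * M))) * ⟦ power g f table p q ⟧ₙ ρ
            ≈⟨ *-cong (*-congˡ (trans (*-identityˡ _) (*-identityˡ _)))
                      (trans (power-sound g f ns p q) (*-cong (^-congˡ p g≈G) (^-congˡ q f≈F))) ⟩
          (ι c * M) * (G ^ p * F ^ q)
            ≈⟨ trans (*-assoc _ _ _) (*-congˡ (trans (*-comm _ _) (*-assoc _ _ _))) ⟩
          ι c * (G ^ p * (F ^ q * M)) ∎

-- Transcriptions of the forms in Defs: at (a, b, λ, μ) they evaluate to Dab, c4ab, …
-- definitionally.
module Pencil where

  a b l m : Expr
  a = var zero
  b = var (suc zero)
  l = var (suc (suc zero))
  m = var (suc (suc (suc zero)))

  D c₄ c₆ f₇ g₇ f₁₇ g₁₇ : Expr → Expr → Expr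
  D x y = x ⊗ y ⊗ ((x ⊛ 10 ⊕ ⊝ (con (+ 11) ⊗ x ⊛ 5 ⊗ y ⊛ 5)) ⊕ ⊝ (y ⊛ 10))
  c₄ x y = x ⊛ 20 ⊕ con (+ 228) ⊗ x ⊛ 15 ⊗ y ⊛ 5 ⊕ con (+ 494) ⊗ x ⊛ 10 ⊗ y ⊛ 10
           ⊕ ⊝ (con (+ 228) ⊗ x ⊛ 5 ⊗ y ⊛ 15) ⊕ y ⊛ 20
  c₆ x y = ⊝ (x ⊛ 30) ⊕ con (+ 522) ⊗ x ⊛ 25 ⊗ y ⊛ 5 ⊕ con (+ 10005) ⊗ x ⊛ 20 ⊗ y ⊛ 10
           ⊕ con (+ 10005) ⊗ x ⊛ 10 ⊗ y ⊛ 20 ⊕ ⊝ (con (+ 522) ⊗ x ⊛ 5 ⊗ y ⊛ 25) ⊕ ⊝ (y ⊛ 30)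
  f₇ x y = y ⊛ 2 ⊗ (con (+ 7) ⊗ x ⊛ 5 ⊕ ⊝ (y ⊛ 5))
  g₇ x y = x ⊛ 2 ⊗ (x ⊛ 5 ⊕ con (+ 7) ⊗ y ⊛ 5)
  f₁₇ x y = y ⊛ 2 ⊗ (con (+ 17) ⊗ x ⊛ 15 ⊕ con (+ 187) ⊗ x ⊛ 10 ⊗ y ⊛ 5
                      ⊕ con (+ 119) ⊗ x ⊛ 5 ⊗ y ⊛ 10 ⊕ y ⊛ 15)
  g₁₇ x y = ⊝ (x ⊛ 2 ⊗ (x ⊛ 15 ⊕ ⊝ (con (+ 119) ⊗ x ⊛ 10 ⊗ y ⊛ 5)
                         ⊕ con (+ 187) ⊗ x ⊛ 5 ⊗ y ⊛ 10 ⊕ ⊝ (con (+ 17) ⊗ y ⊛ 15)))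

  27·D 54²·c₄ 54³·c₆ : Expr → Expr → Expr
  27·D x y   = con (+ 27) ⊗ D x y
  54²·c₄ x y = con (+ 54) ⊛ 2 ⊗ c₄ x y
  54³·c₆ x y = con (+ 54) ⊛ 3 ⊗ c₆ x y

  pencilX pencilY : Expr
  pencilX = l ⊗ f₇ a b ⊕ m ⊗ f₁₇ a b
  pencilY = l ⊗ g₇ a b ⊕ m ⊗ g₁₇ a b

  -- Stated with `≡ true` rather than `T`: checking `refl` against it is far faster
  -- than checking `tt` against `T …`.
  Certifies : NF → ℕ → (Expr → Expr → Expr) → Set
  Certifies P k F =
    (substitute₀₁ (normalise (c₄ a b)) (normalise (c₆ a b)) P *ᴺ normalise (D a b ⊛ k)
       ==ᴺ substitute₀₁ (normalise pencilX) (normalise pencilY) (normalise (F a b))) ≡ true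

module PencilIdentities {c ℓ} (R : CommutativeRing c ℓ) where

  open CommutativeRing R using (_≈_; _*_; *-cong; trans)
  open Semantics R
  open Pencil
  open import Relation.Binary.Reasoning.Setoid (CommutativeRing.setoid R)

  certified⇒identity : ∀ P k F → Certifies P k F → ∀ x y z w {G₄ G₆ X Y} →
              let ρ = x ∷ y ∷ z ∷ w ∷ [] in
              ⟦ c₄ a b ⟧ₑ ρ ≈ G₄ → ⟦ c₆ a b ⟧ₑ ρ ≈ G₆ → ⟦ pencilX ⟧ₑ ρ ≈ X → ⟦ pencilY ⟧ₑ ρ ≈ Y →
              ⟦ P ⟧ₙ (G₄ ∷ G₆ ∷ z ∷ w ∷ []) * ⟦ D a b ⟧ₑ ρ ^ k ≈ ⟦ F a b ⟧ₑ (X ∷ Y ∷ z ∷ w ∷ [])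
  certified⇒identity P k F check x y z w {G₄} {G₆} {X} {Y} c₄≈G₄ c₆≈G₆ pencilX≈X pencilY≈Y = begin
    ⟦ P ⟧ₙ (G₄ ∷ G₆ ∷ z ∷ w ∷ []) * ⟦ D a b ⟧ₑ ρ ^ k
      ≈⟨ *-cong (substitute₀₁-sound ρ c₄ᴺ c₆ᴺ P (trans (normalise-sound ρ (c₄ a b)) c₄≈G₄)
                                                 (trans (normalise-sound ρ (c₆ a b)) c₆≈G₆))
                (normalise-sound ρ (D a b ⊛ k)) ⟨
    ⟦ substitute₀₁ c₄ᴺ c₆ᴺ P ⟧ₙ ρ * ⟦ normalise (D a b ⊛ k) ⟧ₙ ρ
      ≈⟨ *ᴺ-sound ρ (substitute₀₁ c₄ᴺ c₆ᴺ P) (normalise (D a b ⊛ k)) ⟨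
    ⟦ substitute₀₁ c₄ᴺ c₆ᴺ P *ᴺ normalise (D a b ⊛ k) ⟧ₙ ρ
      ≈⟨ ==ᴺ-sound ρ (substitute₀₁ c₄ᴺ c₆ᴺ P *ᴺ normalise (D a b ⊛ k))
                     (substitute₀₁ Xᴺ Yᴺ (normalise (F a b))) check ⟩
    ⟦ substitute₀₁ Xᴺ Yᴺ (normalise (F a b)) ⟧ₙ ρ
      ≈⟨ substitute₀₁-sound ρ Xᴺ Yᴺ (normalise (F a b)) (trans (normalise-sound ρ pencilX) pencilX≈X)
                                                        (trans (normalise-sound ρ pencilY) pencilY≈Y) ⟩
    ⟦ normalise (F a b) ⟧ₙ (X ∷ Y ∷ z ∷ w ∷ [])
      ≈⟨ normalise-sound _ (F a b) ⟩
    ⟦ F a b ⟧ₑ (X ∷ Y ∷ z ∷ w ∷ []) ∎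
    where
    ρ : Point
    ρ = x ∷ y ∷ z ∷ w ∷ []
    c₄ᴺ c₆ᴺ Xᴺ Yᴺ : NF
    c₄ᴺ = normalise (c₄ a b)
    c₆ᴺ = normalise (c₆ a b)
    Xᴺ  = normalise pencilX
    Yᴺ  = normalise pencilY

module PolynomialWitness {c ℓ} (K : CharZeroField c ℓ) where

  open CharZeroField K using (Carrier; commutativeRing; 0#; 1#)
  open FieldOps K using (eval)
  open Semantics commutativeRing hiding (_^_)
  open Semantics commutativeRing using () renaming (_^_ to _^ᵣ_)

  infixr 8 _:^_
  _:^_ : Poly Carrier 4 → ℕ → Poly Carrier 4
  p :^ zero  = con 1#
  p :^ suc n = p :* (p :^ n)

  monomialPoly : Monomial → Poly Carrier 4
  monomialPoly (monomial e₀ e₁ e₂ e₃) =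
    (var zero :^ e₀) :* ((var (suc zero) :^ e₁)
      :* ((var (suc (suc zero)) :^ e₂) :* (var (suc (suc (suc zero))) :^ e₃)))

  toPoly : NF → Poly Carrier 4
  toPoly []          = con 0#
  toPoly (c · x ∷ p) = (con (ι c) :* monomialPoly x) :+ toPoly p

  eval-:^ : ∀ p n ρ → eval (p :^ n) ρ ≡ eval p ρ ^ᵣ n
  eval-:^ p zero    ρ = ≡.refl
  eval-:^ p (suc n) ρ = ≡.cong (eval p ρ *_) (eval-:^ p n ρ)
    where open CharZeroField K using (_*_)

  eval-toPoly : ∀ p ρ → eval (toPoly p) ρ ≡ ⟦ p ⟧ₙ ρ
  eval-toPoly []                               ρ = ≡.refl
  eval-toPoly (c · monomial e₀ e₁ e₂ e₃ ∷ p) ρ =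
    ≡.cong₂ _+_ (≡.cong (ι c *_) (≡.cong₂ _*_ (eval-:^ _ e₀ ρ) (≡.cong₂ _*_ (eval-:^ _ e₁ ρ)
                  (≡.cong₂ _*_ (eval-:^ _ e₂ ρ) (eval-:^ _ e₃ ρ)))))
                (eval-toPoly p ρ)
    where open CharZeroField K using (_+_; _*_)

  ^-agrees : ∀ x n → FieldOps._^_ K x n ≡ x ^ᵣ n
  ^-agrees x zero    = ≡.refl
  ^-agrees x (suc n) = ≡.cong (x *_) (^-agrees x n)
    where open CharZeroField K using (_*_)

  certified⇒polynomialIdentity : ∀ P k F → Pencil.Certifies P k F → ∀ a b l m →
    let open CharZeroField K using (_≈_; _*_)
        open FieldOps K hiding (eval)
    in eval (toPoly P) (c4ab a b ∷ c6ab a b ∷ l ∷ m ∷ []) * Dab a b ^ k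
         ≈ ⟦ F Pencil.a Pencil.b ⟧ₑ (pencilX a b l m ∷ pencilY a b l m ∷ l ∷ m ∷ [])
  certified⇒polynomialIdentity P k F check a b l m =
    trans (*-cong (reflexive (eval-toPoly P _)) (reflexive (^-agrees _ k)))
          (PencilIdentities.certified⇒identity commutativeRing P k F check a b l m refl refl refl refl)
    where open CharZeroField K using (trans; reflexive; refl; *-cong)

-- Integer literals are overloaded only here: elsewhere every ℕ literal would become an
-- instance-dependent term, and checking the uses of the certificate checks would then
-- evaluate them again.
module Certificates where

  open import Agda.Builtin.FromNat using (Number; fromNat)
  open import Agda.Builtin.FromNeg using (Negative; fromNeg)
  import Data.Integer.Literals as ℤLiterals
  import Data.Nat.Literals as ℕLiterals

  instance
    ℕ-number : Number ℕ
    ℕ-number = ℕLiterals.number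

    ℤ-number : Number ℤ
    ℤ-number = ℤLiterals.number

    ℤ-negative : Negative ℤ
    ℤ-negative = ℤLiterals.negative

  certificateD certificate₄ certificate₆ : NF
  certificateD =
      -64 · monomial 0 2 12 0
    ∷ -125 · monomial 3 0 12 0
    ∷ -1620 · monomial 2 1 11 1
    ∷ -3696 · monomial 1 2 10 2
    ∷ -1650 · monomial 4 0 10 2
    ∷ -3520 · monomial 0 3 9 3
    ∷ -2420 · monomial 3 1 9 3
    ∷ 5940 · monomial 2 2 8 4
    ∷ 7425 · monomial 5 0 8 4
    ∷ 22176 · monomial 1 3 7 5
    ∷ 41976 · monomial 4 1 7 5
    ∷ 10560 · monomial 0 4 6 6
    ∷ 108240 · monomial 3 2 6 6
    ∷ 5940 · monomial 6 0 6 6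
    ∷ 104544 · monomial 2 3 5 7
    ∷ 45144 · monomial 5 1 5 7
    ∷ 55440 · monomial 1 4 4 8
    ∷ 51480 · monomial 4 2 4 8
    ∷ 13365 · monomial 7 0 4 8
    ∷ 17600 · monomial 0 5 3 9
    ∷ 29920 · monomial 3 3 3 9
    ∷ 17820 · monomial 6 1 3 9
    ∷ 9504 · monomial 2 4 2 10
    ∷ 19008 · monomial 5 2 2 10
    ∷ -5346 · monomial 8 0 2 10
    ∷ -6720 · monomial 1 5 1 11
    ∷ 19680 · monomial 4 3 1 11
    ∷ -8100 · monomial 7 1 1 11
    ∷ -1600 · monomial 0 6 0 12
    ∷ 2896 · monomial 3 4 0 12
    ∷ -108 · monomial 6 2 0 12
    ∷ -729 · monomial 9 0 0 12
    ∷ []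
  certificate₄ =
      -3584 · monomial 1 4 20 0
    ∷ 9625 · monomial 4 2 20 0
    ∷ -3125 · monomial 7 0 20 0
    ∷ -10240 · monomial 0 5 19 1
    ∷ 48560 · monomial 3 3 19 1
    ∷ 20000 · monomial 6 1 19 1
    ∷ 185440 · monomial 2 4 18 2
    ∷ 249850 · monomial 5 2 18 2
    ∷ 118750 · monomial 8 0 18 2
    ∷ 510720 · monomial 1 5 17 3
    ∷ 1502520 · monomial 4 3 17 3
    ∷ 1311000 · monomial 7 1 17 3
    ∷ 364800 · monomial 0 6 16 4
    ∷ 5002320 · monomial 3 4 16 4
    ∷ 8654025 · monomial 6 2 16 4
    ∷ 106875 · monomial 9 0 16 4
    ∷ 6234432 · monomial 2 5 15 5
    ∷ 34415232 · monomial 5 3 15 5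
    ∷ 4560000 · monomial 8 1 15 5
    ∷ 3575040 · monomial 1 6 14 6
    ∷ 71810880 · monomial 4 4 14 6
    ∷ 35073240 · monomial 7 2 14 6
    ∷ 2565000 · monomial 10 0 14 6
    ∷ 1459200 · monomial 0 7 13 7
    ∷ 97930560 · monomial 3 5 13 7
    ∷ 96972960 · monomial 6 3 13 7
    ∷ 29685600 · monomial 9 1 13 7
    ∷ 95203680 · monomial 2 6 12 8
    ∷ 164916960 · monomial 5 4 12 8
    ∷ 102206130 · monomial 8 2 12 8
    ∷ 5001750 · monomial 11 0 12 8
    ∷ 55328000 · monomial 1 7 11 9
    ∷ 190249280 · monomial 4 5 11 9
    ∷ 233523680 · monomial 7 3 11 9
    ∷ 10670400 · monomial 10 1 11 9
    ∷ 15808000 · monomial 0 8 10 10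
    ∷ 105961024 · monomial 3 6 10 10
    ∷ 394109248 · monomial 6 4 10 10
    ∷ 32873724 · monomial 9 2 10 10
    ∷ -10003500 · monomial 12 0 10 10
    ∷ -2529280 · monomial 2 7 9 11
    ∷ 399863360 · monomial 5 5 9 11
    ∷ 123914960 · monomial 8 3 9 11
    ∷ -31477680 · monomial 11 1 9 11
    ∷ -33196800 · monomial 1 8 8 12
    ∷ 255259680 · monomial 4 6 8 12
    ∷ 152468160 · monomial 7 4 8 12
    ∷ -16205670 · monomial 10 2 8 12
    ∷ 9003150 · monomial 13 0 8 12
    ∷ -7296000 · monomial 0 9 7 13
    ∷ 141104640 · monomial 3 7 7 13
    ∷ 67177920 · monomial 6 5 7 13
    ∷ -42900480 · monomial 9 3 7 13
    ∷ 67962240 · monomial 12 1 7 13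
    ∷ 112358400 · monomial 2 8 6 14
    ∷ 30387840 · monomial 5 6 6 14
    ∷ -187561920 · monomial 8 4 6 14
    ∷ 149529240 · monomial 11 2 6 14
    ∷ 8310600 · monomial 14 0 6 14
    ∷ 51072000 · monomial 1 9 5 15
    ∷ 125841408 · monomial 4 7 5 15
    ∷ -309850176 · monomial 7 5 5 15
    ∷ 147563424 · monomial 10 3 5 15
    ∷ 30583008 · monomial 13 1 5 15
    ∷ 9120000 · monomial 0 10 4 16
    ∷ 110680320 · monomial 3 8 4 16
    ∷ -179034720 · monomial 6 6 4 16
    ∷ 19343520 · monomial 9 4 4 16
    ∷ 53395605 · monomial 12 2 4 16
    ∷ 623295 · monomial 15 0 4 16
    ∷ 42316800 · monomial 2 9 3 17
    ∷ -47205120 · monomial 5 7 3 17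
    ∷ -20228160 · monomial 8 5 3 17
    ∷ 21792240 · monomial 11 3 3 17
    ∷ 6648480 · monomial 14 1 3 17
    ∷ 8512000 · monomial 1 10 2 18
    ∷ -6517760 · monomial 4 8 2 18
    ∷ -7739840 · monomial 7 6 2 18
    ∷ 3529440 · monomial 10 4 2 18
    ∷ 1523610 · monomial 13 2 2 18
    ∷ 1246590 · monomial 16 0 2 18
    ∷ 1280000 · monomial 0 11 1 19
    ∷ -947200 · monomial 3 9 1 19
    ∷ -1807360 · monomial 6 7 1 19
    ∷ 2589120 · monomial 9 5 1 19
    ∷ -2193480 · monomial 12 3 1 19
    ∷ 1137240 · monomial 15 1 1 19
    ∷ 544000 · monomial 2 10 0 20
    ∷ -1793024 · monomial 5 8 0 20
    ∷ 2497504 · monomial 8 6 0 20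
    ∷ -1843344 · monomial 11 4 0 20
    ∷ 656829 · monomial 14 2 0 20
    ∷ -59049 · monomial 17 0 0 20
    ∷ []
  certificate₆ =
      -32768 · monomial 0 7 30 0
    ∷ 575232 · monomial 3 5 30 0
    ∷ -931875 · monomial 6 3 30 0
    ∷ 546875 · monomial 9 1 30 0
    ∷ 3947520 · monomial 2 6 29 1
    ∷ -3648600 · monomial 5 4 29 1
    ∷ 2081250 · monomial 8 2 29 1
    ∷ 2343750 · monomial 11 0 29 1
    ∷ 12472320 · monomial 1 7 28 2
    ∷ 3737520 · monomial 4 5 28 2
    ∷ 26458875 · monomial 7 3 28 2
    ∷ 25828125 · monomial 10 1 28 2
    ∷ 11878400 · monomial 0 8 27 3
    ∷ 46288640 · monomial 3 6 27 3
    ∷ 288744300 · monomial 6 4 27 3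
    ∷ 310517500 · monomial 9 2 27 3
    ∷ -18125000 · monomial 12 0 27 3
    ∷ -11024640 · monomial 2 7 26 4
    ∷ 1471507560 · monomial 5 5 26 4
    ∷ 2783858625 · monomial 8 3 26 4
    ∷ 70959375 · monomial 11 1 26 4
    ∷ -168376320 · monomial 1 8 25 5
    ∷ 3531117024 · monomial 4 6 25 5
    ∷ 15245996580 · monomial 7 4 25 5
    ∷ 3532308750 · monomial 10 2 25 5
    ∷ 298518750 · monomial 13 0 25 5
    ∷ -80179200 · monomial 0 9 24 6
    ∷ 5879808000 · monomial 3 7 24 6
    ∷ 50467482000 · monomial 6 5 24 6
    ∷ 31083710175 · monomial 9 3 24 6
    ∷ 6147365625 · monomial 12 1 24 6
    ∷ 8218368000 · monomial 2 8 23 7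
    ∷ 118165975200 · monomial 5 6 23 7
    ∷ 136441665000 · monomial 8 4 23 7
    ∷ 56564703000 · monomial 11 2 23 7
    ∷ 1174500000 · monomial 14 0 23 7
    ∷ 6454425600 · monomial 1 9 22 8
    ∷ 203393646000 · monomial 4 7 22 8
    ∷ 401960880000 · monomial 7 5 22 8
    ∷ 288126441225 · monomial 10 3 22 8
    ∷ 21689589375 · monomial 13 1 22 8
    ∷ 2049024000 · monomial 0 10 21 9
    ∷ 234933408000 · monomial 3 8 21 9
    ∷ 837845913600 · monomial 6 6 21 9
    ∷ 1024932210000 · monomial 9 4 21 9
    ∷ 150061493250 · monomial 12 2 21 9
    ∷ 3039018750 · monomial 15 0 21 9
    ∷ 175667950080 · monomial 2 9 20 10
    ∷ 1155090056400 · monomial 5 7 20 10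
    ∷ 2642381330400 · monomial 8 5 20 10
    ∷ 732104779455 · monomial 11 3 20 10
    ∷ 25764125625 · monomial 14 1 20 10
    ∷ 81756057600 · monomial 1 10 19 11
    ∷ 1026858772800 · monomial 4 8 19 11
    ∷ 4756349786400 · monomial 7 6 19 11
    ∷ 2487265611300 · monomial 10 4 19 11
    ∷ 253654964100 · monomial 13 2 19 11
    ∷ -4052025000 · monomial 16 0 19 11
    ∷ 19465728000 · monomial 0 11 18 12
    ∷ 558909715200 · monomial 3 9 18 12
    ∷ 6185767338000 · monomial 6 7 18 12
    ∷ 5418886089000 · monomial 9 5 18 12
    ∷ 1375077845325 · monomial 12 3 18 12
    ∷ 61462465875 · monomial 15 1 18 12
    ∷ 148912819200 · monomial 2 10 17 13
    ∷ 6170574945600 · monomial 5 8 17 13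
    ∷ 8111095120800 · monomial 8 6 17 13
    ∷ 3730382459100 · monomial 11 4 17 13
    ∷ 662254861950 · monomial 14 2 17 13
    ∷ 34644813750 · monomial 17 0 17 13
    ∷ 5007193545600 · monomial 4 9 16 14
    ∷ 9039473478000 · monomial 7 7 16 14
    ∷ 6352062444000 · monomial 10 5 16 14
    ∷ 2166361589475 · monomial 13 3 16 14
    ∷ 333745039125 · monomial 16 1 16 14
    ∷ 3405139799040 · monomial 3 10 15 15
    ∷ 7944498904320 · monomial 6 8 15 15
    ∷ 7853289802560 · monomial 9 6 15 15
    ∷ 4171265230320 · monomial 12 4 15 15
    ∷ 1051231433040 · monomial 15 2 15 15
    ∷ 1824182035200 · monomial 2 11 14 16
    ∷ 5472546105600 · monomial 5 9 14 16
    ∷ 7692277816800 · monomial 8 7 14 16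
    ∷ 6133346740800 · monomial 11 5 14 16
    ∷ 2023847367975 · monomial 14 3 14 16
    ∷ -247363970175 · monomial 17 1 14 16
    ∷ 613170432000 · monomial 1 12 13 17
    ∷ 2360706163200 · monomial 4 10 13 17
    ∷ 5735333433600 · monomial 7 8 13 17
    ∷ 8085090124800 · monomial 10 6 13 17
    ∷ 3554677650600 · monomial 13 4 13 17
    ∷ -1428752119050 · monomial 16 2 13 17
    ∷ -62360664750 · monomial 19 0 13 17
    ∷ 97328640000 · monomial 0 13 12 18
    ∷ -194900601600 · monomial 3 11 12 18
    ∷ 1656290131200 · monomial 6 9 12 18
    ∷ 9228062925600 · monomial 9 7 12 18
    ∷ 7299967359600 · monomial 12 5 12 18
    ∷ -4065992330175 · monomial 15 3 12 18
    ∷ -401186943225 · monomial 18 1 12 18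
    ∷ -821402496000 · monomial 2 12 11 19
    ∷ -2911868006400 · monomial 5 10 11 19
    ∷ 6321360700800 · monomial 8 8 11 19
    ∷ 14308875662400 · monomial 11 6 11 19
    ∷ -6845010194700 · monomial 14 4 11 19
    ∷ -1463251059900 · monomial 17 2 11 19
    ∷ 13128561000 · monomial 20 0 11 19
    ∷ -376508160000 · monomial 1 13 10 20
    ∷ -3908085546240 · monomial 4 11 10 20
    ∷ -1428756261120 · monomial 7 9 10 20
    ∷ 19875388407840 · monomial 10 7 10 20
    ∷ -5929989833160 · monomial 13 5 10 20
    ∷ -3496029631245 · monomial 16 3 10 20
    ∷ -5010734115 · monomial 19 1 10 20
    ∷ -51225600000 · monomial 0 14 9 21
    ∷ -2080835097600 · monomial 3 12 9 21
    ∷ -6429760473600 · monomial 6 10 9 21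
    ∷ 16375639728000 · monomial 9 8 9 21
    ∷ -297452652000 · monomial 12 6 9 21
    ∷ -4953816670500 · monomial 15 4 9 21
    ∷ -291964609350 · monomial 18 2 9 21
    ∷ -17723557350 · monomial 21 0 9 21
    ∷ -534795264000 · monomial 2 13 8 22
    ∷ -5560372396800 · monomial 5 11 8 22
    ∷ 8192049177600 · monomial 8 9 8 22
    ∷ 3116551096800 · monomial 11 7 8 22
    ∷ -3451871473200 · monomial 14 5 8 22
    ∷ -683378068275 · monomial 17 3 8 22
    ∷ -156558089925 · monomial 20 1 8 22
    ∷ -84188160000 · monomial 1 14 7 23
    ∷ -2771674675200 · monomial 4 12 7 23
    ∷ 2854399564800 · monomial 7 10 7 23
    ∷ 2434917024000 · monomial 10 8 7 23
    ∷ -1655515692000 · monomial 13 6 7 23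
    ∷ 48476313000 · monomial 16 4 7 23
    ∷ -493519732200 · monomial 19 2 7 23
    ∷ -12329431200 · monomial 22 0 7 23
    ∷ -10022400000 · monomial 0 15 6 24
    ∷ -1097385984000 · monomial 3 13 6 24
    ∷ 940617273600 · monomial 6 11 6 24
    ∷ 1364193964800 · monomial 9 9 6 24
    ∷ -1606577043600 · monomial 12 7 6 24
    ∷ 1112941166400 · monomial 15 5 6 24
    ∷ -528457877325 · monomial 18 3 6 24
    ∷ -81810913275 · monomial 21 1 6 24
    ∷ -344770560000 · monomial 2 14 5 25
    ∷ 84130430976 · monomial 5 12 5 25
    ∷ 1235914661376 · monomial 8 10 5 25
    ∷ -1754292833280 · monomial 11 8 5 25
    ∷ 1105757360640 · monomial 14 6 5 25
    ∷ -166127669280 · monomial 17 4 5 25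
    ∷ -132531110874 · monomial 20 2 5 25
    ∷ -5640714774 · monomial 23 0 5 25
    ∷ -70156800000 · monomial 1 15 4 26
    ∷ -134380339200 · monomial 4 13 4 26
    ∷ 725771093760 · monomial 7 11 4 26
    ∷ -847900051200 · monomial 10 9 4 26
    ∷ 288201315600 · monomial 13 7 4 26
    ∷ 159521529600 · monomial 16 5 4 26
    ∷ -104643193275 · monomial 19 3 4 26
    ∷ -12098254365 · monomial 22 1 4 26
    ∷ -7424000000 · monomial 0 16 3 27
    ∷ -68865024000 · monomial 3 14 3 27
    ∷ 222479016960 · monomial 6 12 3 27
    ∷ -185863997440 · monomial 9 10 3 27
    ∷ -25850692800 · monomial 12 8 3 27
    ∷ 93014762400 · monomial 15 6 3 27
    ∷ -9075831300 · monomial 18 4 3 27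
    ∷ -18391401540 · monomial 21 2 3 27
    ∷ 616471560 · monomial 24 0 3 27
    ∷ -14922240000 · monomial 2 15 2 28
    ∷ 35265484800 · monomial 5 13 2 28
    ∷ -13854631680 · monomial 8 11 2 28
    ∷ -21970214400 · monomial 11 9 2 28
    ∷ 10727413200 · monomial 14 7 2 28
    ∷ 13407622200 · monomial 17 5 2 28
    ∷ -8661996225 · monomial 20 3 2 28
    ∷ 77058945 · monomial 23 1 2 28
    ∷ -1075200000 · monomial 1 16 1 29
    ∷ 1594368000 · monomial 4 14 1 29
    ∷ 937774080 · monomial 7 12 1 29
    ∷ 362503680 · monomial 10 10 1 29
    ∷ -7930526400 · monomial 13 8 1 29
    ∷ 10185199200 · monomial 16 6 1 29
    ∷ -4880727900 · monomial 19 4 1 29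
    ∷ 954822330 · monomial 22 2 1 29
    ∷ -143489070 · monomial 25 0 1 29
    ∷ -102400000 · monomial 0 17 0 30
    ∷ 565760000 · monomial 3 15 0 30
    ∷ -1895731200 · monomial 6 13 0 30
    ∷ 4195985152 · monomial 9 11 0 30
    ∷ -5743802240 · monomial 12 9 0 30
    ∷ 4720025520 · monomial 15 7 0 30
    ∷ -2272380480 · monomial 18 5 0 30
    ∷ 614011185 · monomial 21 3 0 30
    ∷ -81310473 · monomial 24 1 0 30
    ∷ []

module Checks where

  open Pencil using (Certifies; 27·D; 54²·c₄; 54³·c₆)
  open Certificates using (certificateD; certificate₄; certificate₆)

  checkD : Certifies certificateD 2 27·D
  checkD = ≡.refl

  check₄ : Certifies certificate₄ 0 54²·c₄
  check₄ = ≡.refl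

  check₆ : Certifies certificate₆ 0 54³·c₆
  check₆ = ≡.refl

lemma5p6 : ∀ {c ℓ} (K : CharZeroField c ℓ) →
  let open CharZeroField K
      open FieldOps K
  in ∃ λ (PD : Poly Carrier 4) → ∃ λ (P4 : Poly Carrier 4) → ∃ λ (P6 : Poly Carrier 4) →
    ∀ a b l m →
      (eval PD (c4ab a b ∷ c6ab a b ∷ l ∷ m ∷ []) * Dab a b ^ 2
         ≈ natK 27 * Dab (pencilX a b l m) (pencilY a b l m))
      × (eval P4 (c4ab a b ∷ c6ab a b ∷ l ∷ m ∷ [])
         ≈ natK 54 ^ 2 * c4ab (pencilX a b l m) (pencilY a b l m))
      × (eval P6 (c4ab a b ∷ c6ab a b ∷ l ∷ m ∷ [])
         ≈ natK 54 ^ 3 * c6ab (pencilX a b l m) (pencilY a b l m))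
lemma5p6 K = toPoly certificateD , toPoly certificate₄ , toPoly certificate₆ , λ a b l m →
    certified⇒polynomialIdentity certificateD 2 27·D checkD a b l m
  , trans (sym (*-identityʳ _)) (certified⇒polynomialIdentity certificate₄ 0 54²·c₄ check₄ a b l m)
  , trans (sym (*-identityʳ _)) (certified⇒polynomialIdentity certificate₆ 0 54³·c₆ check₆ a b l m)
  where
  open CharZeroField K using (trans; sym; *-identityʳ)
  open PolynomialWitness K
  open Certificates using (certificateD; certificate₄; certificate₆)
  open Pencil using (27·D; 54²·c₄; 54³·c₆)
  open Checks using (checkD; check₄; check₆)
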